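{- Let $G$ be a 2-tree on $k\ge 6$ vertices with $G\ne T(k)$. Let $B(G)$ be the set of all ears of $G$ and $C(G)=\{e(u): u\in B(G)\}$. Then $|C(G)|\ge 2$.
   Context: A simple graph $G$ is a 2-tree if $G=K_3$, or $G$ has a vertex $v$ of degree 2 whose two neighbors are adjacent and $G-v$ is a 2-tree. An ear of a 2-tree is a vertex of degree 2 whose two neighbors are adjacent; for an ear $u$ with neighbors $v,w$, $e(u)$ denotes the edge $vw$ (one says $u$ is attached to $vw$). $T(k)=K_2\vee\overline{K_{k-2}}$ is the join of an edge with $k-2$ independent vertices. -}

module Defs where

open import Data.Nat using (ℕ; zero; suc; _+_)
open import Data.Fin using (Fin; zero; suc; punchIn; _≟_)
open import Data.Bool using (Bool; true; false; if_then_else_; not; _∨_; _∧_)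
open import Data.List using (List; map; allFin)
open import Data.Nat.ListAction using (sum)
open import Data.Product using (Σ; _×_; _,_)
open import Relation.Nullary using (¬_)
open import Relation.Nullary.Decidable using (isYes)
open import Relation.Binary.PropositionalEquality using (_≡_; refl)
open import Function.Bundles using (_⤖_; Func)
open import Function.Bundles using (Bijection)

record Graph (n : ℕ) : Set where
  field
    adj    : Fin n → Fin n → Bool
    sym    : ∀ i j → adj i j ≡ adj j i
    irrefl : ∀ i → adj i i ≡ false
open Graph public

_≅_ : ∀ {n} → Graph n → Graph n → Set
_≅_ {n} G H = Σ (Fin n ⤖ Fin n) λ f →
  ∀ i j → adj G i j ≡ adj H (Bijection.to f i) (Bijection.to f j)

degree : ∀ {n} → Graph n → Fin n → ℕ
degree {n} G v = sum (map (λ j → if adj G v j then 1 else 0) (allFin n))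

delete : ∀ {n} → Graph (suc n) → Fin (suc n) → Graph n
delete G v = record
  { adj = λ i j → adj G (punchIn v i) (punchIn v j)
  ; sym = λ i j → sym G (punchIn v i) (punchIn v j)
  ; irrefl = λ i → irrefl G (punchIn v i) }

K : (n : ℕ) → Graph n
K n = record
  { adj = λ i j → not (isYes (i ≟ j))
  ; sym = symK
  ; irrefl = irrK }
  where
  open import Relation.Binary.PropositionalEquality using () renaming (sym to ≡sym)
  symK : ∀ (i j : Fin n) → not (isYes (i ≟ j)) ≡ not (isYes (j ≟ i))
  symK i j with i ≟ j | j ≟ i
  ... | Relation.Nullary.yes _ | Relation.Nullary.yes _ = refl
  ... | Relation.Nullary.no _ | Relation.Nullary.no _ = refl
  ... | Relation.Nullary.yes p | Relation.Nullary.no q = Data.Empty.⊥-elim (q (≡sym p))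
    where import Data.Empty
  ... | Relation.Nullary.no p | Relation.Nullary.yes q = Data.Empty.⊥-elim (p (≡sym q))
    where import Data.Empty
  irrK : ∀ (i : Fin n) → not (isYes (i ≟ i)) ≡ false
  irrK i with i ≟ i
  ... | Relation.Nullary.yes _ = refl
  ... | Relation.Nullary.no p = Data.Empty.⊥-elim (p refl)
    where import Data.Empty

isHub : ∀ {n} → Fin n → Bool
isHub zero = true
isHub (suc zero) = true
isHub (suc (suc _)) = false

-- T(k) = K_2 ∨ complement(K_{k-2}): vertices 0,1 adjacent to everything,
-- the remaining k-2 vertices pairwise non-adjacent.
T : (k : ℕ) → Graph k
T k = record
  { adj = λ i j → adj (K k) i j ∧ (isHub i ∨ isHub j)
  ; sym = symT
  ; irrefl = λ i → irrT i }
  where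
  open import Data.Bool.Properties using (∨-comm)
  open import Relation.Binary.PropositionalEquality using (cong₂)
  symT : ∀ (i j : Fin k) → (adj (K k) i j ∧ (isHub i ∨ isHub j)) ≡ (adj (K k) j i ∧ (isHub j ∨ isHub i))
  symT i j = cong₂ _∧_ (sym (K k) i j) (∨-comm (isHub i) (isHub j))
  irrT : ∀ (i : Fin k) → (adj (K k) i i ∧ (isHub i ∨ isHub i)) ≡ false
  irrT i rewrite irrefl (K k) i = refl

-- u is an ear of G attached to the edge vw: u has degree 2,
-- v and w are neighbours of u, and v, w are adjacent
-- (so v ≠ w, and {v,w} is exactly the neighbourhood of u).
AttachedTo : ∀ {n} → Graph n → Fin n → Fin n → Fin n → Set
AttachedTo G u v w =
  degree G u ≡ 2 × adj G u v ≡ true × adj G u w ≡ true × adj G v w ≡ true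

IsEar : ∀ {n} → Graph n → Fin n → Set
IsEar {n} G u = Σ (Fin n) λ v → Σ (Fin n) λ w → AttachedTo G u v w

data TwoTree : {n : ℕ} → Graph n → Set where
  base : (G : Graph 3) → G ≅ K 3 → TwoTree G
  step : ∀ {n} (G : Graph (suc n)) (v : Fin (suc n)) →
         IsEar G v → TwoTree (delete G v) → TwoTree G

SameEdge : ∀ {n} → Fin n → Fin n → Fin n → Fin n → Set
SameEdge a b c d = (a ≡ c × b ≡ d) Data.Sum.⊎ (a ≡ d × b ≡ c)
  where import Data.Sum

-- We prove a stronger invariant for every 2-tree, by induction along its
-- construction: G is either a BOOK with spine pq (p ~ q, and every other vertex
-- has neighbourhood exactly {p, q}), or it has TWO distinct, non-adjacent EARS
-- attached to different edges.  K₃ is a book.  Adding an ear v on an edge st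
-- keeps two non-adjacent ears (at most one of them lies in {s, t}, and then
-- the other pairs with v); a book stays a book if st is the spine, and
-- otherwise v pairs with a further page.  A book is isomorphic to T(k), which
-- finishes the proof.
module Submission where

open import Defs renaming (sym to adj-sym)
open import Data.Bool using (Bool; true; false; not; _∨_; _∧_; if_then_else_)
open import Data.Bool.Properties using (¬-not; ∨-zeroʳ)
open import Data.Empty using (⊥-elim)
open import Data.Fin using (Fin; zero; suc; punchIn; punchOut; _≟_)
open import Data.Fin.Permutation using (transpose; _∘ₚ_)
import Data.Fin.Permutation.Components as PC
open import Data.Fin.Properties using (punchIn-injective; punchInᵢ≢i; punchIn-punchOut; any?)
open import Data.List using (tabulate)
open import Data.List.Properties using (map-tabulate)
open import Data.Nat using (ℕ; zero; suc; _+_; _≥_)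
open import Data.Nat.ListAction using () renaming (sum to listSum)
open import Data.Nat.Properties using (suc-injective; 1+n≢0; +-0-commutativeMonoid)
open import Algebra.Properties.CommutativeMonoid.Sum +-0-commutativeMonoid
  using (sum-remove) renaming (sum to ∑)
open import Data.Product using (Σ; _×_; _,_)
open import Data.Sum using (_⊎_; inj₁; inj₂; [_,_]′)
open import Function using (_∘_; id)
open import Function.Bundles using (Bijection; _⤖_)
open import Function.Properties.Inverse using (↔⇒⤖)
open import Relation.Nullary using (¬_; yes; no)
open import Relation.Nullary.Decidable using (isYes; ¬?; _×-dec_)
open import Relation.Binary.PropositionalEquality
  using (_≡_; _≢_; refl; sym; trans; cong; cong₂; subst; module ≡-Reasoning)

true≢false : true ≢ false
true≢false ()

adj⇒≢ : ∀ {n} (G : Graph n) {a b} → adj G a b ≡ true → a ≢ b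
adj⇒≢ G {a} a~b refl = true≢false (trans (sym a~b) (irrefl G a))

indicator : Bool → ℕ
indicator b = if b then 1 else 0

count : ∀ {n} → (Fin n → Bool) → ℕ
count f = ∑ (λ i → indicator (f i))

listSum-tabulate : ∀ {n} (g : Fin n → ℕ) → listSum (tabulate g) ≡ ∑ g
listSum-tabulate {zero} g = refl
listSum-tabulate {suc n} g = cong (g zero +_) (listSum-tabulate (g ∘ suc))

degree≡count : ∀ {n} (G : Graph n) u → degree G u ≡ count (adj G u)
degree≡count G u =
  trans (cong listSum (map-tabulate id (indicator ∘ adj G u))) (listSum-tabulate (indicator ∘ adj G u))

count-remove : ∀ {n} (f : Fin (suc n) → Bool) {a} → f a ≡ true →
               count f ≡ suc (count (f ∘ punchIn a))
count-remove f {a} fa =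
  trans (sum-remove {i = a} (indicator ∘ f))
        (cong (λ b → indicator b + count (f ∘ punchIn a)) fa)

survives-removal : ∀ {n} (f : Fin (suc n) → Bool) {a j} (a≢j : a ≢ j) →
                   f j ≡ true → (f ∘ punchIn a) (punchOut a≢j) ≡ true
survives-removal f a≢j fj = subst (λ i → f i ≡ true) (sym (punchIn-punchOut a≢j)) fj

count-allFalse : ∀ {n} (f : Fin n → Bool) → (∀ i → f i ≡ false) → count f ≡ 0
count-allFalse {zero} f none = refl
count-allFalse {suc n} f none rewrite none zero = count-allFalse (f ∘ suc) (none ∘ suc)

count-zero : ∀ {n} (f : Fin n → Bool) {i} → count f ≡ 0 → f i ≢ true
count-zero {suc n} f c fi = 1+n≢0 (trans (sym (count-remove f fi)) c)

count-one : ∀ {n} (f : Fin n → Bool) {a b} → count f ≡ 1 →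
            f a ≡ true → f b ≡ true → a ≡ b
count-one {suc n} f {a} {b} c fa fb with a ≟ b
... | yes a≡b = a≡b
... | no a≢b = ⊥-elim (count-zero (f ∘ punchIn a)
                  (suc-injective (trans (sym (count-remove f fa)) c))
                  (survives-removal f a≢b fb))

count-two : ∀ {n} (f : Fin n → Bool) {a b z} → count f ≡ 2 → a ≢ b →
            f a ≡ true → f b ≡ true → f z ≡ true → z ≡ a ⊎ z ≡ b
count-two {suc n} f {a} {b} {z} c a≢b fa fb fz with z ≟ a
... | yes z≡a = inj₁ z≡a
... | no z≢a = inj₂ (begin
    z                          ≡⟨ sym (punchIn-punchOut a≢z) ⟩
    punchIn a (punchOut a≢z)   ≡⟨ cong (punchIn a) same ⟩
    punchIn a (punchOut a≢b)   ≡⟨ punchIn-punchOut a≢b ⟩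
    b                          ∎)
  where
  open ≡-Reasoning
  a≢z : a ≢ z
  a≢z = z≢a ∘ sym
  same : punchOut a≢z ≡ punchOut a≢b
  same = count-one (f ∘ punchIn a) (suc-injective (trans (sym (count-remove f fa)) c))
                   (survives-removal f a≢z fz) (survives-removal f a≢b fb)

count-singleton : ∀ {n} (f : Fin n → Bool) {a} → f a ≡ true →
                  (∀ i → f i ≡ true → i ≡ a) → count f ≡ 1
count-singleton {suc n} f {a} fa only =
  trans (count-remove f fa)
        (cong suc (count-allFalse _ λ i → ¬-not (punchInᵢ≢i a i ∘ only (punchIn a i))))

count-pair : ∀ {n} (f : Fin n → Bool) {a b} → a ≢ b → f a ≡ true → f b ≡ true →
             (∀ i → f i ≡ true → i ≡ a ⊎ i ≡ b) → count f ≡ 2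
count-pair {suc n} f {a} {b} a≢b fa fb only =
  trans (count-remove f fa)
        (cong suc (count-singleton _ (survives-removal f a≢b fb) only′))
  where
  only′ : ∀ i → f (punchIn a i) ≡ true → i ≡ punchOut a≢b
  only′ i fi with only (punchIn a i) fi
  ... | inj₁ i≡a = ⊥-elim (punchInᵢ≢i a i i≡a)
  ... | inj₂ i≡b = punchIn-injective a i _ (trans i≡b (sym (punchIn-punchOut a≢b)))

record Nbhd {n} (G : Graph n) (u a b : Fin n) : Set where
  constructor nbhd
  field
    a≢b  : a ≢ b
    u~a  : adj G u a ≡ true
    u~b  : adj G u b ≡ true
    only : ∀ z → adj G u z ≡ true → z ≡ a ⊎ z ≡ b

record Ear {n} (G : Graph n) (u a b : Fin n) : Set where
  constructor ear
  field
    nbhd-is : Nbhd G u a b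
    a~b     : adj G a b ≡ true

attached⇒ear : ∀ {n} (G : Graph n) {u a b} → AttachedTo G u a b → Ear G u a b
attached⇒ear G {u} (deg , u~a , u~b , a~b) =
  ear (nbhd (adj⇒≢ G a~b) u~a u~b
            (λ z → count-two (adj G u) (trans (sym (degree≡count G u)) deg)
                             (adj⇒≢ G a~b) u~a u~b))
      a~b

ear⇒attached : ∀ {n} (G : Graph n) {u a b} → Ear G u a b → AttachedTo G u a b
ear⇒attached G {u} (ear (nbhd a≢b u~a u~b only) a~b) =
  trans (degree≡count G u) (count-pair (adj G u) a≢b u~a u~b only) , u~a , u~b , a~b

nbhd-swap : ∀ {n} {G : Graph n} {u a b} → Nbhd G u a b → Nbhd G u b a
nbhd-swap (nbhd a≢b u~a u~b only) =
  nbhd (a≢b ∘ sym) u~b u~a (λ z → Data.Sum.swap ∘ only z)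

ear-swap : ∀ {n} {G : Graph n} {u a b} → Ear G u a b → Ear G u b a
ear-swap {G = G} {a = a} {b} (ear nb a~b) = ear (nbhd-swap nb) (trans (adj-sym G b a) a~b)

outside-nbhd : ∀ {n} {G : Graph n} {u a b z} → Nbhd G u a b →
               z ≢ a → z ≢ b → adj G z u ≡ false
outside-nbhd {G = G} {u} {z = z} nb z≢a z≢b =
  trans (adj-sym G z u) (¬-not λ u~z → [ z≢a , z≢b ]′ (Nbhd.only nb z u~z))

punchIn-inj : ∀ {n} (v : Fin (suc n)) {i j} → punchIn v i ≡ punchIn v j → i ≡ j
punchIn-inj v = punchIn-injective v _ _

data Split {n} (v : Fin (suc n)) : Fin (suc n) → Set where
  removed : Split v v
  kept    : (w : Fin n) → Split v (punchIn v w)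

split : ∀ {n} (v w : Fin (suc n)) → Split v w
split v w with w ≟ v
... | yes refl = removed
... | no w≢v = subst (Split v) (punchIn-punchOut (w≢v ∘ sym)) (kept _)

lift-nbhd : ∀ {n} (G : Graph (suc n)) v {z c d} → Nbhd (delete G v) z c d →
            adj G (punchIn v z) v ≡ false →
            Nbhd G (punchIn v z) (punchIn v c) (punchIn v d)
lift-nbhd G v {z} (nbhd c≢d z~c z~d only) z≁v =
  nbhd (c≢d ∘ punchIn-inj v) z~c z~d only′
  where
  only′ : ∀ w → adj G (punchIn v z) w ≡ true → w ≡ punchIn v _ ⊎ w ≡ punchIn v _
  only′ w z~w with split v w
  ... | removed = ⊥-elim (true≢false (trans (sym z~w) z≁v))
  ... | kept w′ = Data.Sum.map (cong (punchIn v)) (cong (punchIn v)) (only w′ z~w)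

lift-ear : ∀ {n} (G : Graph (suc n)) v {z c d} → Ear (delete G v) z c d →
           adj G (punchIn v z) v ≡ false →
           Ear G (punchIn v z) (punchIn v c) (punchIn v d)
lift-ear G v (ear nb c~d) z≁v = ear (lift-nbhd G v nb z≁v) c~d

distinct-edges-inj : ∀ {m n} (f : Fin m → Fin n) → (∀ {i j} → f i ≡ f j → i ≡ j) →
                     ∀ {a b c d} → ¬ SameEdge a b c d → ¬ SameEdge (f a) (f b) (f c) (f d)
distinct-edges-inj f inj ¬same (inj₁ (a≡c , b≡d)) = ¬same (inj₁ (inj a≡c , inj b≡d))
distinct-edges-inj f inj ¬same (inj₂ (a≡d , b≡c)) = ¬same (inj₂ (inj a≡d , inj b≡c))

record Book {n} (G : Graph n) (p q : Fin n) : Set where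
  constructor book
  field
    p≢q  : p ≢ q
    p~q  : adj G p q ≡ true
    page : ∀ z → z ≢ p → z ≢ q → Nbhd G z p q

book-swap : ∀ {n} {G : Graph n} {p q} → Book G p q → Book G q p
book-swap {G = G} {p} {q} (book p≢q p~q page) =
  book (p≢q ∘ sym) (trans (adj-sym G q p) p~q) (λ z z≢q z≢p → nbhd-swap (page z z≢p z≢q))

data Role {n} (p q i : Fin n) : Set where
  spine : i ≡ p ⊎ i ≡ q → Role p q i
  leaf  : i ≢ p → i ≢ q → Role p q i

role : ∀ {n} (p q i : Fin n) → Role p q i
role p q i with i ≟ p | i ≟ q
... | yes i≡p | _       = spine (inj₁ i≡p)
... | no _    | yes i≡q = spine (inj₂ i≡q)
... | no i≢p  | no i≢q  = leaf i≢p i≢q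

spine-adjacent : ∀ {n} {G : Graph n} {p q i j} → Book G p q →
                 i ≡ p ⊎ i ≡ q → i ≢ j → adj G i j ≡ true
spine-adjacent {G = G} {p} {q} {i} {j} bk i-spine i≢j with role p q j | i-spine
... | spine (inj₁ refl) | inj₁ refl = ⊥-elim (i≢j refl)
... | spine (inj₂ refl) | inj₂ refl = ⊥-elim (i≢j refl)
... | spine (inj₂ refl) | inj₁ refl = Book.p~q bk
... | spine (inj₁ refl) | inj₂ refl = trans (adj-sym G q p) (Book.p~q bk)
... | leaf j≢p j≢q | inj₁ refl = trans (adj-sym G p j) (Nbhd.u~a (Book.page bk j j≢p j≢q))
... | leaf j≢p j≢q | inj₂ refl = trans (adj-sym G q j) (Nbhd.u~b (Book.page bk j j≢p j≢q))

pages-nonadjacent : ∀ {n} {G : Graph n} {p q i j} → Book G p q →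
                    i ≢ p → i ≢ q → j ≢ p → j ≢ q → adj G i j ≡ false
pages-nonadjacent bk i≢p i≢q j≢p j≢q = outside-nbhd (Book.page bk _ j≢p j≢q) i≢p i≢q

transpose-right : ∀ {n} (i j : Fin n) → PC.transpose i j j ≡ i
transpose-right i j with j ≟ i
... | yes j≡i = j≡i
... | no _ with j ≟ j
...   | yes _ = refl
...   | no j≢j = ⊥-elim (j≢j refl)

transpose-other : ∀ {n} (i j k : Fin n) → k ≢ i → k ≢ j → PC.transpose i j k ≡ k
transpose-other i j k k≢i k≢j with k ≟ i
... | yes k≡i = ⊥-elim (k≢i k≡i)
... | no _ with k ≟ j
...   | yes k≡j = ⊥-elim (k≢j k≡j)
...   | no _ = refl

module SpineFirst {m} (p q : Fin (suc (suc m))) (p≢q : p ≢ q) where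
  -- After swapping 0 and p, the vertex q sits at r; then swap 1 and r.
  r : Fin (suc (suc m))
  r = PC.transpose zero p q

  π : Fin (suc (suc m)) ⤖ Fin (suc (suc m))
  π = ↔⇒⤖ (transpose zero p ∘ₚ transpose (suc zero) r)

  open Bijection π public using (to; injective)

  r≢0 : r ≢ zero
  r≢0 r≡0 = p≢q (sym (begin
    q                                        ≡⟨ sym (PC.transpose-inverse p zero) ⟩
    PC.transpose p zero r                    ≡⟨ cong (PC.transpose p zero) r≡0 ⟩
    PC.transpose p zero zero                 ≡⟨ transpose-right p zero ⟩
    p                                        ∎))
    where open ≡-Reasoning

  to-p : to p ≡ zero
  to-p = trans (cong (PC.transpose (suc zero) r) (transpose-right zero p))
               (transpose-other (suc zero) r zero (λ ()) (r≢0 ∘ sym))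

  to-q : to q ≡ suc zero
  to-q = transpose-right (suc zero) r

  hub-spine : ∀ {i} → i ≡ p ⊎ i ≡ q → isHub (to i) ≡ true
  hub-spine (inj₁ refl) = cong isHub to-p
  hub-spine (inj₂ refl) = cong isHub to-q

  hub-leaf : ∀ {i} → i ≢ p → i ≢ q → isHub (to i) ≡ false
  hub-leaf {i} i≢p i≢q =
    not-hub (to i) (λ e → i≢p (injective (trans e (sym to-p))))
                   (λ e → i≢q (injective (trans e (sym to-q))))
    where
    not-hub : ∀ x → x ≢ zero → x ≢ suc zero → isHub x ≡ false
    not-hub zero x≢0 _ = ⊥-elim (x≢0 refl)
    not-hub (suc zero) _ x≢1 = ⊥-elim (x≢1 refl)
    not-hub (suc (suc x)) _ _ = refl

book⇒≅T : ∀ {n} {G : Graph n} {p q} → Book G p q → G ≅ T n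
book⇒≅T {zero} {p = ()}
book⇒≅T {suc zero} {p = zero} {zero} bk = ⊥-elim (Book.p≢q bk refl)
book⇒≅T {suc (suc m)} {G} {p} {q} bk = π , preserves
  where
  open SpineFirst p q (Book.p≢q bk)

  off-diagonal : ∀ {i j} → i ≢ j → adj G i j ≡ isHub (to i) ∨ isHub (to j)
  off-diagonal {i} {j} i≢j with role p q i | role p q j
  ... | spine i-sp | _ =
    trans (spine-adjacent bk i-sp i≢j) (sym (cong (_∨ _) (hub-spine i-sp)))
  ... | leaf _ _ | spine j-sp =
    trans (trans (adj-sym G i j) (spine-adjacent bk j-sp (i≢j ∘ sym)))
          (sym (trans (cong (isHub (to i) ∨_) (hub-spine j-sp)) (∨-zeroʳ _)))
  ... | leaf i≢p i≢q | leaf j≢p j≢q =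
    trans (pages-nonadjacent bk i≢p i≢q j≢p j≢q)
          (sym (cong₂ _∨_ (hub-leaf i≢p i≢q) (hub-leaf j≢p j≢q)))

  distinct-labels : ∀ {i j} → i ≢ j → not (isYes (to i ≟ to j)) ≡ true
  distinct-labels {i} {j} i≢j with to i ≟ to j
  ... | yes e = ⊥-elim (i≢j (injective e))
  ... | no _ = refl

  preserves : ∀ i j → adj G i j ≡ adj (T (suc (suc m))) (to i) (to j)
  preserves i j with i ≟ j
  ... | yes refl = trans (irrefl G i) (sym (irrefl (T _) (to i)))
  ... | no i≢j = trans (off-diagonal i≢j)
                       (sym (cong (_∧ (isHub (to i) ∨ isHub (to j))) (distinct-labels i≢j)))

record TwoEars {n} (G : Graph n) : Set where
  constructor twoEars
  field
    x a b y c d     : Fin n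
    ear₁            : Ear G x a b
    ear₂            : Ear G y c d
    different-edges : ¬ SameEdge a b c d
    x≢y             : x ≢ y
    x≁y             : adj G x y ≡ false

data Shape {n} (G : Graph n) : Set where
  isBook      : ∀ p q → Book G p q → Shape G
  hasTwoEars  : TwoEars G → Shape G

-- An ear y of G - v not adjacent to the endpoint s of the edge st carrying
-- the new ear v pairs up with v: y avoids {s, t} (t ~ s), so it stays an
-- ear, and its edge avoids s, so it differs from st.
pairWithNewEar : ∀ {n} (G : Graph (suc n)) v {s t y c d} → Ear G v s t →
                 Ear (delete G v) y c d → punchIn v y ≢ s →
                 adj G s (punchIn v y) ≡ false → TwoEars G
pairWithNewEar G v {s} {t} {y} {c} {d} ev ey y≢s s≁y =
  twoEars _ _ _ v s t (lift-ear G v ey y≁v) ev different-edges (punchInᵢ≢i v y) y≁v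
  where
  y≢t : punchIn v y ≢ t
  y≢t y≡t = true≢false (trans (sym (Ear.a~b ev)) (trans (cong (adj G s) (sym y≡t)) s≁y))
  y≁v : adj G (punchIn v y) v ≡ false
  y≁v = outside-nbhd (Ear.nbhd-is ev) y≢s y≢t
  not-neighbour-s : ∀ {w} → w ≡ s → adj G (punchIn v y) w ≢ true
  not-neighbour-s refl y~s = true≢false (trans (sym y~s) (trans (adj-sym G _ s) s≁y))
  different-edges : ¬ SameEdge (punchIn v c) (punchIn v d) s t
  different-edges (inj₁ (c≡s , _)) = not-neighbour-s c≡s (Nbhd.u~a (Ear.nbhd-is ey))
  different-edges (inj₂ (_ , d≡s)) = not-neighbour-s d≡s (Nbhd.u~b (Ear.nbhd-is ey))

-- Two ears of G - v give two ears of G: both survive unless one of them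
-- lies on the edge st of v, in which case the other one pairs with v.
stepTwoEars : ∀ {n} (G : Graph (suc n)) v {s t} → Ear G v s t →
              TwoEars (delete G v) → TwoEars G
stepTwoEars G v {s} {t} ev (twoEars x a b y c d ex ey different x≢y x≁y)
  with punchIn v x ≟ s | punchIn v x ≟ t | punchIn v y ≟ s | punchIn v y ≟ t
... | yes refl | _ | _ | _ = pairWithNewEar G v ev ey (x≢y ∘ sym ∘ punchIn-inj v) x≁y
... | no _ | yes refl | _ | _ = pairWithNewEar G v (ear-swap ev) ey (x≢y ∘ sym ∘ punchIn-inj v) x≁y
... | no _ | no _ | yes refl | _ = pairWithNewEar G v ev ex (x≢y ∘ punchIn-inj v) y≁x
  where
  y≁x : adj (delete G v) y x ≡ false
  y≁x = trans (adj-sym (delete G v) y x) x≁y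
... | no _ | no _ | no _ | yes refl = pairWithNewEar G v (ear-swap ev) ex (x≢y ∘ punchIn-inj v) y≁x
  where
  y≁x : adj (delete G v) y x ≡ false
  y≁x = trans (adj-sym (delete G v) y x) x≁y
... | no x≢s | no x≢t | no y≢s | no y≢t =
  twoEars _ _ _ _ _ _
    (lift-ear G v ex (outside-nbhd (Ear.nbhd-is ev) x≢s x≢t))
    (lift-ear G v ey (outside-nbhd (Ear.nbhd-is ev) y≢s y≢t))
    (distinct-edges-inj (punchIn v) (punchIn-inj v) different)
    (x≢y ∘ punchIn-inj v) x≁y

bookGrows : ∀ {n} (G : Graph (suc n)) v {p q} → Ear G v (punchIn v p) (punchIn v q) →
            Book (delete G v) p q → Book G (punchIn v p) (punchIn v q)
bookGrows G v {p} {q} ev (book p≢q p~q page) =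
  book (p≢q ∘ punchIn-inj v) p~q page′
  where
  page′ : ∀ z → z ≢ punchIn v p → z ≢ punchIn v q → Nbhd G z (punchIn v p) (punchIn v q)
  page′ z z≢p z≢q with split v z
  ... | removed = Ear.nbhd-is ev
  ... | kept z′ = lift-nbhd G v (page z′ (z≢p ∘ cong (punchIn v)) (z≢q ∘ cong (punchIn v)))
                    (outside-nbhd (Ear.nbhd-is ev) z≢p z≢q)

triangleBook : ∀ {n} (G : Graph (suc n)) v {h h′ l} →
               Ear G v (punchIn v h) (punchIn v l) → Book (delete G v) h h′ →
               l ≢ h → l ≢ h′ → (∀ z → z ≡ h ⊎ z ≡ h′ ⊎ z ≡ l) →
               Book G (punchIn v h) (punchIn v l)
triangleBook G v {h} {h′} {l} ev bk l≢h l≢h′ triangle =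
  book (l≢h ∘ sym ∘ punchIn-inj v) (Ear.a~b ev) page
  where
  h′≁v : adj G (punchIn v h′) v ≡ false
  h′≁v = outside-nbhd (Ear.nbhd-is ev) (Book.p≢q bk ∘ sym ∘ punchIn-inj v)
                                       (l≢h′ ∘ sym ∘ punchIn-inj v)
  only : ∀ w → adj G (punchIn v h′) w ≡ true → w ≡ punchIn v h ⊎ w ≡ punchIn v l
  only w h′~w with split v w
  ... | removed = ⊥-elim (true≢false (trans (sym h′~w) h′≁v))
  ... | kept w′ with triangle w′
  ...   | inj₁ refl = inj₁ refl
  ...   | inj₂ (inj₂ refl) = inj₂ refl
  ...   | inj₂ (inj₁ refl) = ⊥-elim (true≢false (trans (sym h′~w) (irrefl G _)))
  h′-nbhd : Nbhd G (punchIn v h′) (punchIn v h) (punchIn v l)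
  h′-nbhd = nbhd (l≢h ∘ sym ∘ punchIn-inj v)
    (trans (adj-sym G _ _) (Book.p~q bk))
    (trans (adj-sym G _ _) (Nbhd.u~b (Book.page bk l l≢h l≢h′)))
    only
  page : ∀ z → z ≢ punchIn v h → z ≢ punchIn v l → Nbhd G z (punchIn v h) (punchIn v l)
  page z z≢h z≢l with split v z
  ... | removed = Ear.nbhd-is ev
  ... | kept z′ with triangle z′
  ...   | inj₁ refl = ⊥-elim (z≢h refl)
  ...   | inj₂ (inj₂ refl) = ⊥-elim (z≢l refl)
  ...   | inj₂ (inj₁ refl) = h′-nbhd

-- If G - v has a further page z, then z and v are two ears; otherwise
-- G - v is the triangle h h′ l and triangleBook applies.
stepBookPage : ∀ {n} (G : Graph (suc n)) v {h h′ l} →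
               Ear G v (punchIn v h) (punchIn v l) → Book (delete G v) h h′ →
               l ≢ h → l ≢ h′ → Shape G
stepBookPage G v {h} {h′} {l} ev bk l≢h l≢h′
  with any? (λ z → ¬? (z ≟ h) ×-dec ¬? (z ≟ h′) ×-dec ¬? (z ≟ l))
... | yes (z , z≢h , z≢h′ , z≢l) =
  hasTwoEars (twoEars _ _ _ v _ _
    (lift-ear G v (ear (Book.page bk z z≢h z≢h′) (Book.p~q bk)) z≁v) ev
    different-edges (punchInᵢ≢i v z) z≁v)
  where
  z≁v : adj G (punchIn v z) v ≡ false
  z≁v = outside-nbhd (Ear.nbhd-is ev) (z≢h ∘ punchIn-inj v) (z≢l ∘ punchIn-inj v)
  different-edges : ¬ SameEdge (punchIn v h) (punchIn v h′) (punchIn v h) (punchIn v l)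
  different-edges (inj₁ (_ , h′≡l)) = l≢h′ (sym (punchIn-inj v h′≡l))
  different-edges (inj₂ (h≡l , _)) = l≢h (sym (punchIn-inj v h≡l))
... | no no-fourth = isBook _ _ (triangleBook G v ev bk l≢h l≢h′ triangle)
  where
  triangle : ∀ z → z ≡ h ⊎ z ≡ h′ ⊎ z ≡ l
  triangle z with z ≟ h | z ≟ h′ | z ≟ l
  ... | yes z≡h | _ | _ = inj₁ z≡h
  ... | no _ | yes z≡h′ | _ = inj₂ (inj₁ z≡h′)
  ... | no _ | no _ | yes z≡l = inj₂ (inj₂ z≡l)
  ... | no z≢h | no z≢h′ | no z≢l = ⊥-elim (no-fourth (z , z≢h , z≢h′ , z≢l))

stepBookSpine : ∀ {n} (G : Graph (suc n)) v {h h′ l} →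
                Ear G v (punchIn v h) (punchIn v l) → Book (delete G v) h h′ → Shape G
stepBookSpine G v {h} {h′} {l} ev bk with l ≟ h′
... | yes refl = isBook _ _ (bookGrows G v ev bk)
... | no l≢h′ = stepBookPage G v ev bk (adj⇒≢ (delete G v) (Ear.a~b ev) ∘ sym) l≢h′

-- Adding an ear to a book: the edge st of G - v carrying v has an endpoint
-- on the spine, since two pages are never adjacent.
stepBook : ∀ {n} (G : Graph (suc n)) v {s t p q} → Ear G v s t →
           Book (delete G v) p q → Shape G
stepBook G v {s} {t} {p} {q} ev bk with split v s | split v t
... | removed | _ = ⊥-elim (adj⇒≢ G (Nbhd.u~a (Ear.nbhd-is ev)) refl)
... | kept _ | removed = ⊥-elim (adj⇒≢ G (Nbhd.u~b (Ear.nbhd-is ev)) refl)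
... | kept s′ | kept t′ with s′ ≟ p | s′ ≟ q
...   | yes refl | _ = stepBookSpine G v ev bk
...   | no _ | yes refl = stepBookSpine G v ev (book-swap bk)
...   | no s′≢p | no s′≢q with Nbhd.only (Book.page bk s′ s′≢p s′≢q) t′ (Ear.a~b ev)
...     | inj₁ refl = stepBookSpine G v (ear-swap ev) bk
...     | inj₂ refl = stepBookSpine G v (ear-swap ev) (book-swap bk)

triangleShape : (G : Graph 3) → G ≅ K 3 → Shape G
triangleShape G (f , preserves) = isBook zero (suc zero) (book (λ ()) (edge (λ ())) page)
  where
  edge : ∀ {i j} → i ≢ j → adj G i j ≡ true
  edge {i} {j} i≢j with Bijection.to f i ≟ Bijection.to f j | preserves i j
  ... | yes fi≡fj | _ = ⊥-elim (i≢j (Bijection.injective f fi≡fj))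
  ... | no _ | i~j = i~j
  page : ∀ z → z ≢ zero → z ≢ suc zero → Nbhd G z zero (suc zero)
  page zero z≢0 _ = ⊥-elim (z≢0 refl)
  page (suc zero) _ z≢1 = ⊥-elim (z≢1 refl)
  page (suc (suc zero)) _ _ = nbhd (λ ()) (edge (λ ())) (edge (λ ())) only
    where
    only : ∀ w → adj G (suc (suc zero)) w ≡ true → w ≡ zero ⊎ w ≡ suc zero
    only zero _ = inj₁ refl
    only (suc zero) _ = inj₂ refl
    only (suc (suc zero)) 2~2 = ⊥-elim (true≢false (trans (sym 2~2) (irrefl G _)))

shape : ∀ {n} {G : Graph n} → TwoTree G → Shape G
shape (base G G≅K₃) = triangleShape G G≅K₃
shape (step G v (s , t , attached) H) with shape H
... | isBook p q bk = stepBook G v (attached⇒ear G attached) bk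
... | hasTwoEars te = hasTwoEars (stepTwoEars G v (attached⇒ear G attached) te)

lemma4p1 : (k : ℕ) → k ≥ 6 → (G : Graph k) → TwoTree G → ¬ (G ≅ T k) →
    Σ (Fin k) λ u → Σ (Fin k) λ v → Σ (Fin k) λ w →
    Σ (Fin k) λ u′ → Σ (Fin k) λ v′ → Σ (Fin k) λ w′ →
    AttachedTo G u v w × AttachedTo G u′ v′ w′ × ¬ SameEdge v w v′ w′
lemma4p1 k _ G twoTree G≇T with shape twoTree
... | isBook p q bk = ⊥-elim (G≇T (book⇒≅T bk))
... | hasTwoEars (twoEars x a b y c d ex ey different _ _) =
  x , a , b , y , c , d , ear⇒attached G ex , ear⇒attached G ey , different
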